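{- Let $n\geq1$ and consider the normed BPA system $\Delta_0$ described in the context. Let $\gamma$ be a process with $\mathrm{Var}(\gamma)\subseteq\{B_1^1,B_2^1,\dots,B_n^1\}$. Then the following are equivalent: (1) $Z_1^1Z_2^1\cdots Z_n^1\gamma\simeq\gamma$; (2) $Z_1^1Z_2^1\cdots Z_n^1\gamma\approx\gamma$; (3) $\mathrm{Var}(\gamma)=\{B_1^1,B_2^1,\dots,B_n^1\}$.
   Context: BPA systems: a BPA system $(\mathcal{V},\mathcal{A},\mathcal{R})$ has finite sets of variables, actions (containing the internal action $\tau$) and rules $X\xrightarrow{\lambda}\alpha$; processes are words over $\mathcal{V}$; if $X\xrightarrow{\lambda}\alpha$ is a rule then $X\beta\xrightarrow{\lambda}\alpha\beta$. Write $\to$ for $\xrightarrow{\tau}$, $\Rightarrow$ for its reflexive transitive closure, $\mathrm{Var}(\alpha)$ for the set of variables occurring in $\alpha$. A symmetric relation $R$ is a branching bisimulation if whenever $\alpha R\beta$ and $\alpha\xrightarrow{\lambda}\alpha'$, either ($\lambda=\tau$ and $\alpha'R\beta$) or $\beta\Rightarrow\beta''\xrightarrow{\lambda}\beta'$ with $\alpha R\beta''$ and $\alpha'R\beta'$; it is a weak bisimulation if whenever $\alpha R\beta$ and $\alpha\xrightarrow{\lambda}\alpha'$, either ($\lambda=\tau$ and $\alpha'R\beta$) or $\beta\Rightarrow\gamma_1\xrightarrow{\lambda}\gamma_2\Rightarrow\beta'$ with $\alpha'R\beta'$. $\simeq$ and $\approx$ are the largest branching and weak bisimulations. The system $\Delta_0$: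 variables $\mathcal{B}\uplus\mathcal{B}'$ with $\mathcal{B}=\{B_i^0,B_i^1\mid 1\le i\le n\}$ and $\mathcal{B}'=\{Z_i^0,Z_i^1\mid 1\le i\le n\}\cup\{B_i^b(j,b')\mid 1\le i,j\le n,\ i\ne j,\ b,b'\in\{0,1\}\}$; actions $\{d,\tau\}\cup\{a_i^0,a_i^1\mid 1\le i\le n\}$; rules, for all $1\le i,j,j'\le n$ and $b,b',b''\in\{0,1\}$: $Z_i^b\xrightarrow{a_i^b}\epsilon$, $Z_i^b\xrightarrow{\tau}\epsilon$; $B_i^b\xrightarrow{a_i^b}B_i^b$, $B_i^b\xrightarrow{d}\epsilon$, $B_i^b\xrightarrow{a_j^{b'}}B_i^b(j,b')$ for $j\ne i$; $B_i^b(j,b')\xrightarrow{a_i^b}B_i^b(j,b')$, $B_i^b(j,b')\xrightarrow{d}Z_j^{b'}$, $B_i^b(j,b')\xrightarrow{a_{j'}^{b''}}B_i^b(j',b'')$ for $j\ne i$, $j'\ne i$. -}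

module Defs where

open import Data.Nat using (ℕ)
open import Data.Fin using (Fin)
open import Data.Bool using (Bool; true)
open import Data.List using (List; []; _∷_; _++_; map; allFin)
open import Data.List.Membership.Propositional using (_∈_)
open import Data.Product using (Σ; ∃; _×_; _,_)
open import Data.Sum using (_⊎_)
open import Relation.Binary.PropositionalEquality using (_≡_; _≢_)
open import Relation.Binary.Construct.Closure.ReflexiveTransitive using (Star)

-- The BPA system Δ₀ for a fixed n.  Indices 1..n are represented by Fin n,
-- superscript bits b ∈ {0,1} by Bool (false = 0, true = 1).
module _ (n : ℕ) where

  data Var : Set where
    B   : Fin n → Bool → Var
    Z   : Fin n → Bool → Var
    Bij : (i : Fin n) → Bool → (j : Fin n) → .(i ≢ j) → Bool → Var

  data Act : Set where
    τ : Act
    d : Act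
    a : Fin n → Bool → Act

  Proc : Set
  Proc = List Var

  data Rule : Var → Act → Proc → Set where
    Z-a   : ∀ i b → Rule (Z i b) (a i b) []
    Z-τ   : ∀ i b → Rule (Z i b) τ []
    B-a   : ∀ i b → Rule (B i b) (a i b) (B i b ∷ [])
    B-d   : ∀ i b → Rule (B i b) d []
    B-aj  : ∀ i b j b' → (p : i ≢ j) → Rule (B i b) (a j b') (Bij i b j p b' ∷ [])
    Bij-a : ∀ i b j b' .(p : i ≢ j) → Rule (Bij i b j p b') (a i b) (Bij i b j p b' ∷ [])
    Bij-d : ∀ i b j b' .(p : i ≢ j) → Rule (Bij i b j p b') d (Z j b' ∷ [])
    Bij-aj : ∀ i b j b' j' b'' .(p : i ≢ j) → (q : i ≢ j') →
             Rule (Bij i b j p b') (a j' b'') (Bij i b j' q b'' ∷ [])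

  data Step : Proc → Act → Proc → Set where
    step : ∀ {X l α} β → Rule X l α → Step (X ∷ β) l (α ++ β)

  _⇒_ : Proc → Proc → Set
  _⇒_ = Star (λ x y → Step x τ y)

  Rel : Set₁
  Rel = Proc → Proc → Set

  Symmetric : Rel → Set
  Symmetric R = ∀ {α β} → R α β → R β α

  IsBranchingBisim : Rel → Set
  IsBranchingBisim R = Symmetric R ×
    (∀ {α β l α'} → R α β → Step α l α' →
       (l ≡ τ × R α' β) ⊎
       (Σ Proc λ β'' → Σ Proc λ β' → (β ⇒ β'') × Step β'' l β' × R α β'' × R α' β'))

  IsWeakBisim : Rel → Set
  IsWeakBisim R = Symmetric R ×
    (∀ {α β l α'} → R α β → Step α l α' →
       (l ≡ τ × R α' β) ⊎
       (Σ Proc λ γ₁ → Σ Proc λ γ₂ → Σ Proc λ β' →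
          (β ⇒ γ₁) × Step γ₁ l γ₂ × (γ₂ ⇒ β') × R α' β'))

  _≃_ : Proc → Proc → Set₁
  α ≃ β = Σ Rel λ R → IsBranchingBisim R × R α β

  _≈_ : Proc → Proc → Set₁
  α ≈ β = Σ Rel λ R → IsWeakBisim R × R α β

  InVar : Proc → Var → Set
  InVar γ X = X ∈ γ

  IsB1 : Var → Set
  IsB1 X = ∃ λ i → X ≡ B i true

  Zs : Proc
  Zs = map (λ i → Z i true) (allFin n)

module Submission where

-- For a list zs of indices write Zl zs for the prefix
-- Z_{j₁}^1 ⋯ Z_{jₘ}^1 (so Zs n = Zl (allFin n)), and call δ a B-process when
-- all its variables are B_i^1's.  Each implication is proved for an
-- arbitrary prefix Zl zs in front of a B-process δ.
--
--  (1) ⇒ (2): every branching bisimulation is a weak bisimulation.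
--  (2) ⇒ (3): B-processes are stable (no τ-moves).  If a weak bisimulation
--    relates Zl zs δ with δ and i ∈ zs, then B_i^1 occurs in δ: δ must answer
--    the a_i^1 of Z_i^1, which its head B_k^1 does either by a_i^1 (k = i) or
--    by moving to B_k^1(i,1); then a d-move leaves Z_i^1 δ' against δ', and
--    we recurse on the tail δ'.
--  (3) ⇒ (1): an explicit branching bisimulation relating Zl zs δ with δ when
--    every index of zs has its B^1 in δ, and Zl zs B_k^1 δ with B_k^1(j,1) δ
--    when B_j^1 occurs in δ (Z_j^1, released by d, is matched by δ's B_j^1).

open import Defs
open import Data.Nat using (ℕ; _≤_)
open import Data.List using (List; []; _∷_; _++_; map; allFin)
open import Data.Product using (_×_; _,_; Σ; proj₁; proj₂)
open import Data.Sum using (_⊎_; inj₁; inj₂)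
open import Data.Bool using (true)
open import Data.Fin using (Fin; _≟_)
open import Data.Empty using (⊥-elim)
open import Relation.Nullary using (¬_; yes; no)
open import Relation.Binary.PropositionalEquality using (_≡_; _≢_; refl; ≢-sym; subst)
open import Relation.Binary.Construct.Closure.ReflexiveTransitive using (ε; _◅_)
open import Data.List.Relation.Unary.All as All using (All; []; _∷_)
open import Data.List.Relation.Unary.Any as Any using (here; there)
open import Data.List.Membership.Propositional using (_∈_)
open import Data.List.Membership.Propositional.Properties using (∈-allFin)
open import Function.Bundles using (_⇔_; mk⇔)

branching⇒weak : ∀ {n} {R : Rel n} → IsBranchingBisim n R → IsWeakBisim n R
branching⇒weak {n} {R} (sym-R , transfer) = sym-R , weak-transfer
  where
  weak-transfer : ∀ {α β l α'} → R α β → Step n α l α' →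
    (l ≡ τ × R α' β) ⊎ (Σ (Proc n) λ γ₁ → Σ (Proc n) λ γ₂ → Σ (Proc n) λ β' →
      _⇒_ n β γ₁ × Step n γ₁ l γ₂ × _⇒_ n γ₂ β' × R α' β')
  weak-transfer r s with transfer r s
  ... | inj₁ silent = inj₁ silent
  ... | inj₂ (β'' , β' , β⇒β'' , s' , _ , r') = inj₂ (β'' , β' , β' , β⇒β'' , s' , ε , r')

≃⇒≈ : ∀ {n} {α β : Proc n} → _≃_ n α β → _≈_ n α β
≃⇒≈ (R , bisim , r) = R , branching⇒weak bisim , r

module _ {n : ℕ} where

  P : Set
  P = Proc n

  Zl : List (Fin n) → P
  Zl zs = map (λ i → Z i true) zs

  IsBProc : P → Set
  IsBProc δ = All (IsB1 n) δ

  Covers : List (Fin n) → P → Set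
  Covers zs δ = All (λ j → B j true ∈ δ) zs

  Zl-⇒ : ∀ zs (δ : P) → _⇒_ n (Zl zs ++ δ) δ
  Zl-⇒ []       δ = ε
  Zl-⇒ (j ∷ zs) δ = step _ (Z-τ j true) ◅ Zl-⇒ zs δ

  Stable : P → Set
  Stable δ = ∀ {γ} → ¬ Step n δ τ γ

  ⇒-stable : ∀ {δ γ} → Stable δ → _⇒_ n δ γ → γ ≡ δ
  ⇒-stable _  ε       = refl
  ⇒-stable st (s ◅ _) = ⊥-elim (st s)

  BProc-stable : ∀ {δ} → IsBProc δ → Stable δ
  BProc-stable ((_ , refl) ∷ _) (step _ ())

  Bij-stable : ∀ {k j} {p : k ≢ j} {δ} → Stable (Bij k true j p true ∷ δ)
  Bij-stable (step _ ())

  d-after-prefix : ∀ zs {k} {δ γ₁ γ₂ : P} →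
    _⇒_ n (Zl zs ++ (B k true ∷ δ)) γ₁ → Step n γ₁ d γ₂ → γ₂ ≡ δ
  d-after-prefix []       ε                          (step _ (B-d _ _)) = refl
  d-after-prefix []       (step _ () ◅ _)            _
  d-after-prefix (_ ∷ zs) ε                          (step _ ())
  d-after-prefix (_ ∷ zs) (step _ (Z-τ _ _) ◅ moves) s = d-after-prefix zs moves s

  module _ {R : Rel n} (wb : IsWeakBisim n R) where
    private
      R-sym = proj₁ wb
      transfer = proj₂ wb

    -- If R relates Zl zs B_k^1 δ with B_k^1(i,1) δ, matching the d-move of
    -- the latter (which releases Z_i^1) forces R to relate Z_i^1 δ with δ.
    d-releases : ∀ zs {k i} {p : k ≢ i} {δ : P} → IsBProc δ →
      R (Zl zs ++ (B k true ∷ δ)) (Bij k true i p true ∷ δ) → R (Z i true ∷ δ) δ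
    d-releases zs {k} {i} {p} {δ} bδ r with transfer (R-sym r) (step δ (Bij-d k true i true p))
    ... | inj₁ (() , _)
    ... | inj₂ (_ , _ , _ , moves₁ , s , moves₂ , r') with d-after-prefix zs moves₁ s
    ... | refl rewrite ⇒-stable (BProc-stable bδ) moves₂ = r'

    -- If R relates Zl zs δ with a B-process δ, then every index of zs has its
    -- B^1 in δ: δ must answer the a_i^1 of Z_i^1 without τ-moves.
    weak-covers : ∀ {i} zs {δ : P} → IsBProc δ → R (Zl zs ++ δ) δ → i ∈ zs → B i true ∈ δ
    weak-covers (j ∷ zs) bδ r (there i∈zs) with transfer r (step _ (Z-τ j true))
    ... | inj₁ (_ , r') = weak-covers zs bδ r' i∈zs
    ... | inj₂ (_ , _ , _ , moves , s , _) rewrite ⇒-stable (BProc-stable bδ) moves =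
      ⊥-elim (BProc-stable bδ s)
    weak-covers {i} (.i ∷ zs) bδ r (here refl) with transfer r (step _ (Z-a i true))
    ... | inj₁ (() , _)
    ... | inj₂ (_ , _ , _ , moves , s , moves' , r') with ⇒-stable (BProc-stable bδ) moves
    weak-covers (_ ∷ _) ((_ , refl) ∷ _) _ (here refl)
      | inj₂ (_ , _ , _ , _ , step _ (B-a _ _) , _ , _) | refl = here refl
    weak-covers {i} (.i ∷ zs) ((k , refl) ∷ bδ') _ (here refl)
      | inj₂ (_ , _ , _ , _ , step δ' (B-aj _ _ _ _ p) , moves' , r') | refl =
      there (weak-covers (i ∷ []) bδ' (d-releases zs {p = p} bδ' pending-pair) (here refl))
      where
      pending-pair : R (Zl zs ++ (B k true ∷ δ')) (Bij k true i p true ∷ δ')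
      pending-pair = subst (R _) (⇒-stable (Bij-stable {p = p}) moves') r'

  data Core : P → P → Set where
    prefix  : ∀ zs {δ} → IsBProc δ → Covers zs δ → Core (Zl zs ++ δ) δ
    pending : ∀ zs {k j δ} (p : k ≢ j) → IsBProc δ → B j true ∈ δ →
              Covers zs (B k true ∷ δ) →
              Core (Zl zs ++ (B k true ∷ δ)) (Bij k true j p true ∷ δ)

  data Bisim : P → P → Set where
    same : ∀ {α} → Bisim α α
    fwd  : ∀ {α β} → Core α β → Bisim α β
    bwd  : ∀ {α β} → Core α β → Bisim β α

  Bisim-sym : Symmetric n Bisim
  Bisim-sym same    = same
  Bisim-sym (fwd c) = bwd c
  Bisim-sym (bwd c) = fwd c

  Answer : P → P → Act n → P → Set
  Answer α β l α' = (l ≡ τ × Bisim α' β) ⊎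
    (Σ P λ β'' → Σ P λ β' → _⇒_ n β β'' × Step n β'' l β' × Bisim α β'' × Bisim α' β')

  mimic : ∀ {α β l α' β'} → Bisim α β → Step n β l β' → Bisim α' β' → Answer α β l α'
  mimic r s r' = inj₂ (_ , _ , ε , s , r , r')

  B-≢ : ∀ {j k : Fin n} → j ≢ k → B j true ≢ B k true
  B-≢ j≢k refl = j≢k refl

  -- The B-process answers a_j^1 when B_j^1 occurs in it (the Z_j^1 move):
  -- its head either performs a_j^1 itself or records the pending index j.
  answer-a : ∀ zs j {δ : P} → IsBProc δ → Covers (j ∷ zs) δ →
             Answer (Zl (j ∷ zs) ++ δ) δ (a j true) (Zl zs ++ δ)
  answer-a zs j {[]} _ (() ∷ _)
  answer-a zs j {_ ∷ δ} b@((k , refl) ∷ bδ) c@(j∈δ ∷ c') with k ≟ j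
  ... | yes refl = mimic (fwd (prefix (j ∷ zs) b c)) (step δ (B-a j true)) (fwd (prefix zs b c'))
  ... | no k≢j   = mimic (fwd (prefix (j ∷ zs) b c)) (step δ (B-aj k true j true k≢j))
                         (fwd (pending zs k≢j bδ (Any.tail (B-≢ (≢-sym k≢j)) j∈δ) c'))

  transfer-fwd : ∀ {α β l α'} → Core α β → Step n α l α' → Answer α β l α'
  transfer-fwd r@(prefix [] _ _) s = mimic (fwd r) s same
  transfer-fwd (prefix (j ∷ zs) b (_ ∷ c)) (step _ (Z-τ _ _)) = inj₁ (refl , fwd (prefix zs b c))
  transfer-fwd (prefix (j ∷ zs) b c) (step _ (Z-a _ _)) = answer-a zs j b c
  transfer-fwd (pending (i ∷ zs) p b m (_ ∷ c)) (step _ (Z-τ _ _)) =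
    inj₁ (refl , fwd (pending zs p b m c))
  transfer-fwd {β = Bij k _ j _ _ ∷ δ} r@(pending (i ∷ zs) p b m (i∈ ∷ c)) (step _ (Z-a _ _))
    with i ≟ k
  ... | yes refl = mimic (fwd r) (step δ (Bij-a i true j true p)) (fwd (pending zs p b m c))
  ... | no i≢k   = mimic (fwd r) (step δ (Bij-aj k true j true i true p k≢i))
                         (fwd (pending zs k≢i b (Any.tail (B-≢ i≢k) i∈) c))
    where
    k≢i : k ≢ i
    k≢i = ≢-sym i≢k
  transfer-fwd r@(pending [] {k} {j} {δ} p b m []) (step _ (B-a _ _)) =
    mimic (fwd r) (step δ (Bij-a k true j true p)) (fwd r)
  transfer-fwd r@(pending [] {k} {j} {δ} p b m []) (step _ (B-d _ _)) =
    mimic (fwd r) (step δ (Bij-d k true j true p)) (bwd (prefix (j ∷ []) b (m ∷ [])))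
  transfer-fwd r@(pending [] {k} {j} {δ} p b m []) (step _ (B-aj _ _ j' b' q)) =
    mimic (fwd r) (step δ (Bij-aj k true j true j' b' p q)) same

  -- Moves of the unprefixed side are answered after silently consuming the
  -- prefix: by the same move for `prefix`, and for `pending` by the move of
  -- the head B_k^1 corresponding to that of B_k^1(j,1).
  after-prefix : ∀ zs {δ δ' β β' l} → Step n δ l δ' → Bisim β δ → Bisim β' δ' →
                 Answer β (Zl zs ++ δ) l β'
  after-prefix zs {δ} s r r' = inj₂ (δ , _ , Zl-⇒ zs δ , s , r , r')

  transfer-bwd : ∀ {α β l β'} → Core α β → Step n β l β' → Answer β α l β'
  transfer-bwd (prefix zs _ _) s = after-prefix zs s same same
  transfer-bwd (pending zs {k} {δ = δ} p b m _) (step _ (Bij-a _ _ _ _ _)) =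
    after-prefix zs (step δ (B-a k true)) (bwd (pending [] p b m [])) (bwd (pending [] p b m []))
  transfer-bwd (pending zs {k} {j} {δ} p b m _) (step _ (Bij-d _ _ _ _ _)) =
    after-prefix zs (step δ (B-d k true)) (bwd (pending [] p b m []))
                 (fwd (prefix (j ∷ []) b (m ∷ [])))
  transfer-bwd (pending zs {k} {δ = δ} p b m _) (step _ (Bij-aj _ _ _ _ j' b' _ q)) =
    after-prefix zs (step δ (B-aj k true j' b' q)) (bwd (pending [] p b m [])) same

  Bisim-transfer : ∀ {α β l α'} → Bisim α β → Step n α l α' → Answer α β l α'
  Bisim-transfer same    s = mimic same s same
  Bisim-transfer (fwd c) s = transfer-fwd c s
  Bisim-transfer (bwd c) s = transfer-bwd c s

  Bisim-branching : IsBranchingBisim n Bisim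
  Bisim-branching = Bisim-sym , Bisim-transfer

  covers⇒≃ : ∀ zs {δ : P} → IsBProc δ → Covers zs δ → _≃_ n (Zl zs ++ δ) δ
  covers⇒≃ zs bδ c = Bisim , Bisim-branching , fwd (prefix zs bδ c)

  ≈⇒covers : ∀ zs {δ : P} → IsBProc δ → _≈_ n (Zl zs ++ δ) δ → Covers zs δ
  ≈⇒covers zs bδ (R , wb , r) = All.tabulate (weak-covers wb zs bδ r)

lemma20 : (n : ℕ) → 1 ≤ n → (γ : Proc n) →
    (∀ X → InVar n γ X → IsB1 n X) →
    ((_≃_ n (Zs n ++ γ) γ ⇔ _≈_ n (Zs n ++ γ) γ)
    × (_≈_ n (Zs n ++ γ) γ ⇔ ((∀ X → InVar n γ X → IsB1 n X) × (∀ X → IsB1 n X → InVar n γ X))))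
lemma20 n _ γ onlyB =
  mk⇔ ≃⇒≈ (λ w → covers⇒≃ indices bγ (≈⇒covers indices bγ w)) ,
  mk⇔ (λ w → onlyB , contains-all (≈⇒covers indices bγ w))
      (λ (_ , hasAll) → ≃⇒≈ (covers⇒≃ indices bγ (covers-all hasAll)))
  where
  indices : List (Fin n)
  indices = allFin n

  bγ : IsBProc γ
  bγ = All.tabulate (onlyB _)

  contains-all : Covers indices γ → ∀ X → IsB1 n X → InVar n γ X
  contains-all c _ (i , refl) = All.lookup c (∈-allFin i)

  covers-all : (∀ X → IsB1 n X → InVar n γ X) → Covers indices γ
  covers-all hasAll = All.tabulate (λ {i} _ → hasAll (B i true) (i , refl))
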